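{- Let $G$ be a graph with no isolated vertices and nonnegative weights $w_v\leq w_e$. Let $S_{wmd}$ be a minimum-weight mixed dominating set and $S_{vc}$ a minimum vertex cover of $G$. Then $w(S_{wmd})\leq w(S_{vc})\leq 2w(S_{wmd})$.
   Context: In a graph $G=(V,E)$, a vertex dominates itself, all its neighbours and all edges incident to it; an edge dominates itself, its two endpoints and all edges sharing an endpoint with it. A mixed dominating set is a set $D\subseteq V\cup E$ such that every vertex and every edge is dominated by at least one element of $D$. For any set $X\subseteq V\cup E$, $w(X)=w_v|X\cap V|+w_e|X\cap E|$. A vertex cover is a set of vertices containing at least one endpoint of every edge.
   Formalization: The weights $w_v$ and $w_e$ are rational. -}

module Defs where

open import Data.Nat using (ℕ) renaming (_≤_ to _≤ℕ_)
open import Data.Fin using (Fin)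
open import Data.Fin.Subset using (Subset; _∈_; ∣_∣)
open import Data.Product using (_×_; _,_; ∃; ∃-syntax; proj₁; proj₂)
open import Data.Sum using (_⊎_)
open import Data.Integer using (+_)
open import Data.Rational using (ℚ; _/_; _+_; _*_; _≤_)
open import Relation.Binary.PropositionalEquality using (_≡_; _≢_)
open import Relation.Nullary using (¬_)

-- A finite simple graph: vertices Fin n, edges indexed by Fin m,
-- each edge has two distinct endpoints and no two edges have the same
-- (unordered) pair of endpoints.
record Graph : Set where
  field
    n   : ℕ
    m   : ℕ
    ends : Fin m → Fin n × Fin n
    loopless : ∀ e → proj₁ (ends e) ≢ proj₂ (ends e)
    simple : ∀ e f → ((proj₁ (ends e) ≡ proj₁ (ends f)) × (proj₂ (ends e) ≡ proj₂ (ends f)))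
                   ⊎ ((proj₁ (ends e) ≡ proj₂ (ends f)) × (proj₂ (ends e) ≡ proj₁ (ends f)))
                   → e ≡ f

module _ (G : Graph) where
  open Graph G

  Incident : Fin n → Fin m → Set
  Incident v e = (v ≡ proj₁ (ends e)) ⊎ (v ≡ proj₂ (ends e))

  Adjacent : Fin n → Fin n → Set
  Adjacent u v = ∃[ e ] (((u ≡ proj₁ (ends e)) × (v ≡ proj₂ (ends e)))
                        ⊎ ((v ≡ proj₁ (ends e)) × (u ≡ proj₂ (ends e))))

  ShareEndpoint : Fin m → Fin m → Set
  ShareEndpoint e f = ∃[ v ] (Incident v e × Incident v f)

  NoIsolatedVertices : Set
  NoIsolatedVertices = ∀ (v : Fin n) → ∃[ e ] Incident v e

  -- A subset of V ∪ E, given as a vertex part and an edge part.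
  Mixed : Set
  Mixed = Subset n × Subset m

  VertexDominated : Mixed → Fin n → Set
  VertexDominated (Dv , De) v =
    (v ∈ Dv) ⊎ (∃[ u ] (u ∈ Dv × Adjacent u v)) ⊎ (∃[ e ] (e ∈ De × Incident v e))

  EdgeDominated : Mixed → Fin m → Set
  EdgeDominated (Dv , De) e =
    (e ∈ De) ⊎ (∃[ v ] (v ∈ Dv × Incident v e)) ⊎ (∃[ f ] (f ∈ De × ShareEndpoint f e))

  IsMixedDominatingSet : Mixed → Set
  IsMixedDominatingSet D = (∀ v → VertexDominated D v) × (∀ e → EdgeDominated D e)

  weight : ℚ → ℚ → Mixed → ℚ
  weight wv we (Dv , De) = wv * ((+ ∣ Dv ∣) / 1) + we * ((+ ∣ De ∣) / 1)

  IsMinWeightMixedDominatingSet : ℚ → ℚ → Mixed → Set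
  IsMinWeightMixedDominatingSet wv we D =
    IsMixedDominatingSet D × (∀ D' → IsMixedDominatingSet D' → weight wv we D ≤ weight wv we D')

  IsVertexCover : Subset n → Set
  IsVertexCover S = ∀ e → ∃[ v ] (v ∈ S × Incident v e)

  IsMinVertexCover : Subset n → Set
  IsMinVertexCover S = IsVertexCover S × (∀ S' → IsVertexCover S' → ∣ S ∣ ≤ℕ ∣ S' ∣)

--  * A vertex cover S is itself a mixed dominating set: every edge has an
--    endpoint in S, and a vertex outside S lies on some edge whose other
--    endpoint is in S.  Minimality of S_wmd gives the first inequality.
--  * A mixed dominating set D = (D_V , D_E) yields the vertex cover
--    D_V ∪ (endpoints of the edges in D_E), of size ≤ |D_V| + 2|D_E|.
--    Minimality of S_vc then gives |S_vc| ≤ |D_V| + 2|D_E| ≤ 2(|D_V| + |D_E|),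
--    and w_v ≤ w_e turns this into w(S_vc) ≤ 2·w(S_wmd).
module Submission where

open import Defs
open import Data.Fin.Subset using (Subset)
open import Data.Product using (_×_; _,_)
open import Data.Rational using (ℚ; 0ℚ; _≤_; _*_; _/_)
open import Data.Integer using (+_)
open import Data.Fin.Subset using (⊥)

open import Data.Nat as ℕ using (ℕ; suc)
import Data.Nat.Properties as ℕP
import Data.Integer as ℤ
import Data.Integer.Properties as ℤP
open import Data.Rational using (_+_; toℚᵘ; NonNegative; nonNegative)
open import Data.Rational.Properties
  using ( toℚᵘ-injective; toℚᵘ-fromℚᵘ; toℚᵘ-homo-+; toℚᵘ-homo-*; toℚᵘ-cancel-≤
        ; *-monoˡ-≤-nonNeg; *-monoʳ-≤-nonNeg; +-monoʳ-≤; *-zeroʳ; +-identityʳ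
        ; module ≤-Reasoning )
import Data.Rational.Unnormalised as ℚᵘ
import Data.Rational.Unnormalised.Properties as ℚᵘP
open import Data.Rational.Solver using (module +-*-Solver)
open import Data.Fin using (Fin)
open import Data.Fin.Subset using (_∈_; _⊆_; ∣_∣; _∪_; ⁅_⁆; inside; outside)
open import Data.Fin.Subset.Properties using (x∈⁅x⁆; x∈p∪q⁺; ∣⁅x⁆∣≡1; ∣⊥∣≡0; _∈?_)
open import Data.Vec using ([]; _∷_; here; there)
open import Data.Product using (proj₁; proj₂)
open import Data.Sum using (_⊎_; inj₁; inj₂)
open import Relation.Nullary using (yes; no; contradiction)
open import Relation.Binary.PropositionalEquality

⟦_⟧ : ℕ → ℚ
⟦ k ⟧ = + k / 1

-- Its unnormalised counterpart k/1; `⟦ k ⟧` is by definition its normal form.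
⟦_⟧ᵘ : ℕ → ℚᵘ.ℚᵘ
⟦ k ⟧ᵘ = ℚᵘ.mkℚᵘ (+ k) 0

toℚᵘ-⟦⟧ : ∀ k → toℚᵘ ⟦ k ⟧ ℚᵘ.≃ ⟦ k ⟧ᵘ
toℚᵘ-⟦⟧ k = toℚᵘ-fromℚᵘ ⟦ k ⟧ᵘ

⟦⟧ᵘ-+ : ∀ a b → ⟦ a ℕ.+ b ⟧ᵘ ℚᵘ.≃ ⟦ a ⟧ᵘ ℚᵘ.+ ⟦ b ⟧ᵘ
⟦⟧ᵘ-+ a b = ℚᵘ.*≡* (cong (ℤ._* + 1) (begin
  + (a ℕ.+ b)                   ≡⟨ ℤP.pos-+ a b ⟩
  + a ℤ.+ + b                   ≡⟨ cong₂ ℤ._+_ (ℤP.*-identityʳ (+ a)) (ℤP.*-identityʳ (+ b)) ⟨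
  + a ℤ.* + 1 ℤ.+ + b ℤ.* + 1   ∎))
  where open ≡-Reasoning

⟦⟧ᵘ-* : ∀ a b → ⟦ a ℕ.* b ⟧ᵘ ℚᵘ.≃ ⟦ a ⟧ᵘ ℚᵘ.* ⟦ b ⟧ᵘ
⟦⟧ᵘ-* a b = ℚᵘ.*≡* (cong (ℤ._* + 1) (ℤP.pos-* a b))

⟦⟧ᵘ-mono : ∀ {a b} → a ℕ.≤ b → ⟦ a ⟧ᵘ ℚᵘ.≤ ⟦ b ⟧ᵘ
⟦⟧ᵘ-mono a≤b = ℚᵘ.*≤* (ℤP.*-monoʳ-≤-nonNeg (+ 1) (ℤ.+≤+ a≤b))

⟦⟧-+ : ∀ a b → ⟦ a ℕ.+ b ⟧ ≡ ⟦ a ⟧ + ⟦ b ⟧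
⟦⟧-+ a b = toℚᵘ-injective (begin
  toℚᵘ ⟦ a ℕ.+ b ⟧              ≈⟨ toℚᵘ-⟦⟧ (a ℕ.+ b) ⟩
  ⟦ a ℕ.+ b ⟧ᵘ                  ≈⟨ ⟦⟧ᵘ-+ a b ⟩
  ⟦ a ⟧ᵘ ℚᵘ.+ ⟦ b ⟧ᵘ            ≈⟨ ℚᵘP.+-cong (toℚᵘ-⟦⟧ a) (toℚᵘ-⟦⟧ b) ⟨
  toℚᵘ ⟦ a ⟧ ℚᵘ.+ toℚᵘ ⟦ b ⟧    ≈⟨ toℚᵘ-homo-+ ⟦ a ⟧ ⟦ b ⟧ ⟨
  toℚᵘ (⟦ a ⟧ + ⟦ b ⟧)          ∎)
  where open ℚᵘP.≃-Reasoning

⟦⟧-* : ∀ a b → ⟦ a ℕ.* b ⟧ ≡ ⟦ a ⟧ * ⟦ b ⟧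
⟦⟧-* a b = toℚᵘ-injective (begin
  toℚᵘ ⟦ a ℕ.* b ⟧              ≈⟨ toℚᵘ-⟦⟧ (a ℕ.* b) ⟩
  ⟦ a ℕ.* b ⟧ᵘ                  ≈⟨ ⟦⟧ᵘ-* a b ⟩
  ⟦ a ⟧ᵘ ℚᵘ.* ⟦ b ⟧ᵘ            ≈⟨ ℚᵘP.*-cong (toℚᵘ-⟦⟧ a) (toℚᵘ-⟦⟧ b) ⟨
  toℚᵘ ⟦ a ⟧ ℚᵘ.* toℚᵘ ⟦ b ⟧    ≈⟨ toℚᵘ-homo-* ⟦ a ⟧ ⟦ b ⟧ ⟨
  toℚᵘ (⟦ a ⟧ * ⟦ b ⟧)          ∎)
  where open ℚᵘP.≃-Reasoning

⟦⟧-mono : ∀ {a b} → a ℕ.≤ b → ⟦ a ⟧ ≤ ⟦ b ⟧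
⟦⟧-mono {a} {b} a≤b = toℚᵘ-cancel-≤
  (ℚᵘP.≤-respʳ-≃ (ℚᵘP.≃-sym (toℚᵘ-⟦⟧ b))
    (ℚᵘP.≤-respˡ-≃ (ℚᵘP.≃-sym (toℚᵘ-⟦⟧ a)) (⟦⟧ᵘ-mono a≤b)))

-- Casts of naturals are nonnegative (needed as instances for monotonicity).
⟦⟧-nonNeg : ∀ k → NonNegative ⟦ k ⟧
⟦⟧-nonNeg k = nonNegative (⟦⟧-mono {0} {k} ℕ.z≤n)

∣p∪q∣≤∣p∣+∣q∣ : ∀ {n} (p q : Subset n) → ∣ p ∪ q ∣ ℕ.≤ ∣ p ∣ ℕ.+ ∣ q ∣
∣p∪q∣≤∣p∣+∣q∣ [] [] = ℕ.z≤n
∣p∪q∣≤∣p∣+∣q∣ (inside ∷ p) (inside ∷ q) =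
  ℕ.s≤s (ℕP.≤-trans (∣p∪q∣≤∣p∣+∣q∣ p q) (ℕP.+-monoʳ-≤ ∣ p ∣ (ℕP.n≤1+n ∣ q ∣)))
∣p∪q∣≤∣p∣+∣q∣ (inside ∷ p) (outside ∷ q) = ℕ.s≤s (∣p∪q∣≤∣p∣+∣q∣ p q)
∣p∪q∣≤∣p∣+∣q∣ (outside ∷ p) (inside ∷ q) =
  ℕP.≤-trans (ℕ.s≤s (∣p∪q∣≤∣p∣+∣q∣ p q)) (ℕP.≤-reflexive (sym (ℕP.+-suc ∣ p ∣ ∣ q ∣)))
∣p∪q∣≤∣p∣+∣q∣ (outside ∷ p) (outside ∷ q) = ∣p∪q∣≤∣p∣+∣q∣ p q

⋃[_]_ : ∀ {m n} → Subset m → (Fin m → Subset n) → Subset n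
⋃[ [] ] F = ⊥
⋃[ inside ∷ X ] F = F Fin.zero ∪ ⋃[ X ] (λ i → F (Fin.suc i))
⋃[ outside ∷ X ] F = ⋃[ X ] (λ i → F (Fin.suc i))

⊆⋃ : ∀ {m n} (X : Subset m) (F : Fin m → Subset n) {i} → i ∈ X → F i ⊆ ⋃[ X ] F
⊆⋃ (inside ∷ X) F here x∈Fi = x∈p∪q⁺ (inj₁ x∈Fi)
⊆⋃ (inside ∷ X) F (there i∈X) x∈Fi = x∈p∪q⁺ (inj₂ (⊆⋃ X _ i∈X x∈Fi))
⊆⋃ (outside ∷ X) F (there i∈X) x∈Fi = ⊆⋃ X _ i∈X x∈Fi

∣⋃∣≤ : ∀ {m n} k (X : Subset m) (F : Fin m → Subset n) →
       (∀ i → ∣ F i ∣ ℕ.≤ k) → ∣ ⋃[ X ] F ∣ ℕ.≤ k ℕ.* ∣ X ∣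
∣⋃∣≤ {n = n} k [] F bound = ℕP.≤-reflexive (trans (∣⊥∣≡0 n) (sym (ℕP.*-zeroʳ k)))
∣⋃∣≤ k (outside ∷ X) F bound = ∣⋃∣≤ k X _ (λ i → bound (Fin.suc i))
∣⋃∣≤ k (inside ∷ X) F bound = begin
  ∣ F Fin.zero ∪ U ∣              ≤⟨ ∣p∪q∣≤∣p∣+∣q∣ (F Fin.zero) U ⟩
  ∣ F Fin.zero ∣ ℕ.+ ∣ U ∣         ≤⟨ ℕP.+-mono-≤ (bound Fin.zero) (∣⋃∣≤ k X _ (λ i → bound (Fin.suc i))) ⟩
  k ℕ.+ k ℕ.* ∣ X ∣               ≡⟨ ℕP.*-suc k ∣ X ∣ ⟨
  k ℕ.* suc ∣ X ∣                 ∎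
  where
  open ℕP.≤-Reasoning
  U = ⋃[ X ] (λ i → F (Fin.suc i))

module _ (G : Graph) where
  open Graph G

  incident⇒≡⊎adjacent : ∀ {u v e} → Incident G u e → Incident G v e →
                         u ≡ v ⊎ Adjacent G u v
  incident⇒≡⊎adjacent (inj₁ u≡x) (inj₁ v≡x) = inj₁ (trans u≡x (sym v≡x))
  incident⇒≡⊎adjacent {e = e} (inj₁ u≡x) (inj₂ v≡y) = inj₂ (e , inj₁ (u≡x , v≡y))
  incident⇒≡⊎adjacent {e = e} (inj₂ u≡y) (inj₁ v≡x) = inj₂ (e , inj₂ (v≡x , u≡y))
  incident⇒≡⊎adjacent (inj₂ u≡y) (inj₂ v≡y) = inj₁ (trans u≡y (sym v≡y))

  vertexCover⇒mixedDominating : NoIsolatedVertices G → (S : Subset n) →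
    IsVertexCover G S → IsMixedDominatingSet G (S , ⊥)
  vertexCover⇒mixedDominating noIsolated S cover =
    vertexDominated , λ e → inj₂ (inj₁ (cover e))
    where
    vertexDominated : ∀ v → VertexDominated G (S , ⊥) v
    vertexDominated v with v ∈? S
    ... | yes v∈S = inj₁ v∈S
    ... | no v∉S with noIsolated v
    ... | e , v∼e with cover e
    ... | u , u∈S , u∼e with incident⇒≡⊎adjacent u∼e v∼e
    ... | inj₁ u≡v = contradiction (subst (_∈ S) u≡v u∈S) v∉S
    ... | inj₂ u-v = inj₂ (inj₁ (u , u∈S , u-v))

  endpoints : Fin m → Subset n
  endpoints e = ⁅ proj₁ (ends e) ⁆ ∪ ⁅ proj₂ (ends e) ⁆

  incident⇒∈endpoints : ∀ {v e} → Incident G v e → v ∈ endpoints e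
  incident⇒∈endpoints (inj₁ refl) = x∈p∪q⁺ (inj₁ (x∈⁅x⁆ _))
  incident⇒∈endpoints (inj₂ refl) = x∈p∪q⁺ (inj₂ (x∈⁅x⁆ _))

  ∣endpoints∣≤2 : ∀ e → ∣ endpoints e ∣ ℕ.≤ 2
  ∣endpoints∣≤2 e = ℕP.≤-trans (∣p∪q∣≤∣p∣+∣q∣ ⁅ x ⁆ ⁅ y ⁆)
                     (ℕP.≤-reflexive (cong₂ ℕ._+_ (∣⁅x⁆∣≡1 x) (∣⁅x⁆∣≡1 y)))
    where
    x = proj₁ (ends e)
    y = proj₂ (ends e)

  inducedCover : Mixed G → Subset n
  inducedCover (Dv , De) = Dv ∪ ⋃[ De ] endpoints

  incident⇒∈inducedCover : ∀ Dv De {f v} → f ∈ De → Incident G v f →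
    v ∈ inducedCover (Dv , De)
  incident⇒∈inducedCover Dv De f∈De v∼f =
    x∈p∪q⁺ (inj₂ (⊆⋃ De endpoints f∈De (incident⇒∈endpoints v∼f)))

  mixedDominating⇒vertexCover : (D : Mixed G) → IsMixedDominatingSet G D →
    IsVertexCover G (inducedCover D)
  mixedDominating⇒vertexCover (Dv , De) (_ , edgeDominated) e with edgeDominated e
  ... | inj₁ e∈De =
        proj₁ (ends e) , incident⇒∈inducedCover Dv De e∈De (inj₁ refl) , inj₁ refl
  ... | inj₂ (inj₁ (v , v∈Dv , v∼e)) =
        v , x∈p∪q⁺ (inj₁ v∈Dv) , v∼e
  ... | inj₂ (inj₂ (f , f∈De , v , v∼f , v∼e)) =
        v , incident⇒∈inducedCover Dv De f∈De v∼f , v∼e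

  -- Each edge of D contributes at most its two endpoints.
  ∣inducedCover∣≤ : (D : Mixed G) →
    ∣ inducedCover D ∣ ℕ.≤ ∣ proj₁ D ∣ ℕ.+ 2 ℕ.* ∣ proj₂ D ∣
  ∣inducedCover∣≤ (Dv , De) = ℕP.≤-trans (∣p∪q∣≤∣p∣+∣q∣ Dv _)
    (ℕP.+-monoʳ-≤ ∣ Dv ∣ (∣⋃∣≤ 2 De endpoints ∣endpoints∣≤2))

  weight-vertices : ∀ wv we (S : Subset n) → weight G wv we (S , ⊥) ≡ wv * ⟦ ∣ S ∣ ⟧
  weight-vertices wv we S = begin
    wv * ⟦ ∣ S ∣ ⟧ + we * ⟦ ∣ ⊥ {n = m} ∣ ⟧  ≡⟨ cong (λ k → wv * ⟦ ∣ S ∣ ⟧ + we * ⟦ k ⟧) (∣⊥∣≡0 m) ⟩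
    wv * ⟦ ∣ S ∣ ⟧ + we * 0ℚ               ≡⟨ cong (_+_ (wv * ⟦ ∣ S ∣ ⟧)) (*-zeroʳ we) ⟩
    wv * ⟦ ∣ S ∣ ⟧ + 0ℚ                    ≡⟨ +-identityʳ _ ⟩
    wv * ⟦ ∣ S ∣ ⟧                         ∎
    where open ≡-Reasoning

a+kb≤k[a+b] : ∀ k .{{_ : ℕ.NonZero k}} a b → a ℕ.+ k ℕ.* b ℕ.≤ k ℕ.* (a ℕ.+ b)
a+kb≤k[a+b] k a b = begin
  a ℕ.+ k ℕ.* b              ≤⟨ ℕP.+-monoˡ-≤ (k ℕ.* b) (ℕP.m≤n*m a k) ⟩
  k ℕ.* a ℕ.+ k ℕ.* b        ≡⟨ ℕP.*-distribˡ-+ k a b ⟨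
  k ℕ.* (a ℕ.+ b)            ∎
  where open ℕP.≤-Reasoning

weight-estimate : (wv we : ℚ) → 0ℚ ≤ wv → wv ≤ we → (s a b : ℕ) →
  s ℕ.≤ a ℕ.+ 2 ℕ.* b → wv * ⟦ s ⟧ ≤ ⟦ 2 ⟧ * (wv * ⟦ a ⟧ + we * ⟦ b ⟧)
weight-estimate wv we 0≤wv wv≤we s a b s≤a+2b = begin
  wv * ⟦ s ⟧                          ≤⟨ *-monoˡ-≤-nonNeg wv (⟦⟧-mono s≤2[a+b]) ⟩
  wv * ⟦ 2 ℕ.* (a ℕ.+ b) ⟧            ≡⟨ cong (wv *_) (trans (⟦⟧-* 2 (a ℕ.+ b)) (cong (⟦ 2 ⟧ *_) (⟦⟧-+ a b))) ⟩
  wv * (⟦ 2 ⟧ * (⟦ a ⟧ + ⟦ b ⟧))      ≡⟨ regroup ⟩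
  ⟦ 2 ⟧ * (wv * ⟦ a ⟧ + wv * ⟦ b ⟧)   ≤⟨ *-monoˡ-≤-nonNeg ⟦ 2 ⟧ (+-monoʳ-≤ (wv * ⟦ a ⟧) wv⟦b⟧≤we⟦b⟧) ⟩
  ⟦ 2 ⟧ * (wv * ⟦ a ⟧ + we * ⟦ b ⟧)   ∎
  where
  open ≤-Reasoning
  instance
    wv-nonNeg : NonNegative wv
    wv-nonNeg = nonNegative 0≤wv
    two-nonNeg : NonNegative ⟦ 2 ⟧
    two-nonNeg = ⟦⟧-nonNeg 2
    b-nonNeg : NonNegative ⟦ b ⟧
    b-nonNeg = ⟦⟧-nonNeg b

  s≤2[a+b] : s ℕ.≤ 2 ℕ.* (a ℕ.+ b)
  s≤2[a+b] = ℕP.≤-trans s≤a+2b (a+kb≤k[a+b] 2 a b)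

  regroup : wv * (⟦ 2 ⟧ * (⟦ a ⟧ + ⟦ b ⟧)) ≡ ⟦ 2 ⟧ * (wv * ⟦ a ⟧ + wv * ⟦ b ⟧)
  regroup = +-*-Solver.solve 4
    (λ w t x y → w :* (t :* (x :+ y)) := t :* (w :* x :+ w :* y))
    refl wv ⟦ 2 ⟧ ⟦ a ⟧ ⟦ b ⟧
    where open +-*-Solver using (_:*_; _:+_; _:=_)

  wv⟦b⟧≤we⟦b⟧ : wv * ⟦ b ⟧ ≤ we * ⟦ b ⟧
  wv⟦b⟧≤we⟦b⟧ = *-monoʳ-≤-nonNeg ⟦ b ⟧ wv≤we

corollary2 : (G : Graph) → NoIsolatedVertices G →
    (wv we : ℚ) → 0ℚ ≤ wv → wv ≤ we →
    (Swmd : Mixed G) → IsMinWeightMixedDominatingSet G wv we Swmd →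
    (Svc : Subset (Graph.n G)) → IsMinVertexCover G Svc →
    (weight G wv we Swmd ≤ weight G wv we (Svc , ⊥))
    × (weight G wv we (Svc , ⊥) ≤ ((+ 2) / 1) * weight G wv we Swmd)
corollary2 G noIsolated wv we 0≤wv wv≤we D (D-dominating , D-minimal) Svc (Svc-cover , Svc-minimal) =
  D-minimal (Svc , ⊥) (vertexCover⇒mixedDominating G noIsolated Svc Svc-cover) ,
  subst (_≤ ⟦ 2 ⟧ * weight G wv we D) (sym (weight-vertices G wv we Svc))
    (weight-estimate wv we 0≤wv wv≤we (∣ Svc ∣) (∣ proj₁ D ∣) (∣ proj₂ D ∣) Svc-size-bound)
  where
  Svc-size-bound : ∣ Svc ∣ ℕ.≤ ∣ proj₁ D ∣ ℕ.+ 2 ℕ.* ∣ proj₂ D ∣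
  Svc-size-bound = ℕP.≤-trans
    (Svc-minimal (inducedCover G D) (mixedDominating⇒vertexCover G D D-dominating))
    (∣inducedCover∣≤ G D)
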